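{- In $ALFAo$, the rule $R_4$ is derivable using only $R_5$, $R_2$, $R_6$ and $R_8$: for all graphs $A,B,C$, $[BC[A]]\vdash[BC[AB]]$ is derivable in the system whose rules are $R_2$, $R_5$, $R_6$, $R_8$.
   Context: Graphs: the empty graph $\emptyset$ and propositional letters are graphs; if $G,H$ are graphs, so are their juxtaposition $GH$ and the cut $[G]$ ($G$ inside a solid closed curve). Juxtaposition is associative and commutative with unit $\emptyset$. Rules are schemata with $A,B,C$ arbitrary (possibly empty) graphs, applied to the whole graph on the sheet. $R_2: AB\vdash A$; $R_5: A[AB]\vdash A[B]$; $R_6: A[[B]]\vdash AB$; $R_8$ (second degree): if $AB\vdash C$ is derivable then $A\vdash[B[C]]$ is derivable. Derivability in a system is the least transitive relation containing all instances of its first-degree rules and closed under its second-degree rules. -}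

module Defs where

open import Data.Nat using (ℕ)

data Graph : Set where
  ∅    : Graph
  var  : ℕ → Graph
  _·_  : Graph → Graph → Graph
  [_]  : Graph → Graph

infixl 6 _·_

data _≈_ : Graph → Graph → Set where
  ≈-refl  : ∀ {G} → G ≈ G
  ≈-sym   : ∀ {G H} → G ≈ H → H ≈ G
  ≈-trans : ∀ {G H K} → G ≈ H → H ≈ K → G ≈ K
  ≈-assoc : ∀ {G H K} → (G · H) · K ≈ G · (H · K)
  ≈-comm  : ∀ {G H} → G · H ≈ H · G
  ≈-unit  : ∀ {G} → ∅ · G ≈ G
  ≈-jux   : ∀ {G G' H H'} → G ≈ G' → H ≈ H' → G · H ≈ G' · H'
  ≈-cut   : ∀ {G G'} → G ≈ G' → [ G ] ≈ [ G' ]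

infix 4 _≈_ _⊢_

data _⊢_ : Graph → Graph → Set where
  R2    : ∀ A B → A · B ⊢ A
  R5    : ∀ A B → A · [ A · B ] ⊢ A · [ B ]
  R6    : ∀ A B → A · [ [ B ] ] ⊢ A · B
  R8    : ∀ {A B C} → A · B ⊢ C → A ⊢ [ B · [ C ] ]
  trans : ∀ {G H K} → G ⊢ H → H ⊢ K → G ⊢ K
  resp  : ∀ {G G' H H'} → G ≈ G' → H ≈ H' → G ⊢ H → G' ⊢ H'

module Submission where

open import Defs

-- Under the hypothesis BC, the cut [BC[A]] yields A by modus ponens; keeping B and
-- discarding C gives AB, and R8 discharges the hypothesis BC into the cut.

modus-ponens : ∀ P Q → [ P · [ Q ] ] · P ⊢ P · Q
modus-ponens P Q = trans (resp ≈-comm ≈-refl (R5 P [ Q ])) (R6 P Q)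

erase-right : ∀ {G} A B C → G ⊢ (B · C) · A → G ⊢ A · B
erase-right A B C G⊢BCA =
  trans G⊢BCA (resp (≈-trans ≈-assoc ≈-comm) ≈-refl (R2 (A · B) C))

mainTheorem3 : ∀ A B C → [ B · C · [ A ] ] ⊢ [ B · C · [ A · B ] ]
mainTheorem3 A B C = R8 (erase-right A B C (modus-ponens (B · C) A))
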